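{- Let $k$ be a positive integer. Every $2^k$-$T_0T^\ast$-perfect number $n>1$ has the form $n=p_1^{2^{k+1}-1}$ for some prime $p_1$.
   Context: $T(m)$ denotes the product of all positive divisors of $m$. A divisor $d$ of $m$ is unitary if $\gcd(d,m/d)=1$, and $T^\ast(m)$ denotes the product of all unitary divisors of $m$. For an integer $K\ge 2$, an integer $n>1$ is called $K$-$T_0T^\ast$-perfect if $T(T^\ast(n))=n^K$. -}

module Defs where

open import Data.Nat using (ℕ; zero; suc; _*_; _^_; _≟_)
open import Data.Nat.Divisibility using (_∣_; _∣?_)
open import Data.Nat.DivMod using (_/_)
open import Data.Nat.GCD using (gcd)
open import Data.Nat.ListAction using (product)
open import Data.List using (List; filter; map)
open import Data.List.Base using (applyUpTo)
open import Relation.Binary.PropositionalEquality using (_≡_)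

range1 : ℕ → List ℕ
range1 m = applyUpTo suc m

divisors : ℕ → List ℕ
divisors m = filter (λ d → d ∣? m) (range1 m)

-- cofactor m / d (d = 0 never occurs among positive divisors)
cofactor : ℕ → ℕ → ℕ
cofactor m zero = 0
cofactor m (suc d) = m / suc d

unitaryDivisors : ℕ → List ℕ
unitaryDivisors m = filter (λ d → gcd d (cofactor m d) ≟ 1) (divisors m)

T : ℕ → ℕ
T m = product (divisors m)

T* : ℕ → ℕ
T* m = product (unitaryDivisors m)

-- n > 1 is K-T0T*-perfect  (K ≥ 2 is a hypothesis carried separately)
IsKT0T*Perfect : ℕ → ℕ → Set
IsKT0T*Perfect K n = T (T* n) ≡ n ^ K

-- T and T* are products over divisor lists closed under d ↦ m / d, so pairing d with m / d gives
-- T(m)² = m^τ(m) and T*(n)² = n^τ*(n). Hence T(T*(n)) = n^K yields n^(τ*(n) τ(T*(n))) = n^(4K), so for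
-- K = 2^k both τ*(n) and τ(T*(n)) are powers of 2. If τ*(n) = 2^s with s ≥ 2, then T*(n) = n^(2^(s-1)) is a
-- nontrivial square, whose number of divisors is odd: impossible. So τ*(n) = 2 and T*(n) = n. Writing
-- n = p^a r with p ∤ r, the unitary divisors 1, p^a, n force r = 1, and then a + 1 = τ(n) = 2^(k+1).

module Submission where

open import Data.List using (List; []; _∷_; [_]; map; filter; length; upTo)
open import Data.List.Membership.Propositional using (_∈_)
open import Data.List.Membership.Propositional.Properties
  using (∈-filter⁺; ∈-filter⁻; ∈-map⁺; ∈-map⁻; ∈-applyUpTo⁺; ∈-applyUpTo⁻; ∈-upTo⁺; ∈-upTo⁻)
open import Data.List.Membership.Propositional.Properties.WithK using (unique∧set⇒bag)
open import Data.List.Properties using (length-filter; length-map; length-upTo)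
open import Data.List.Relation.Binary.BagAndSetEquality using (∼bag⇒↭)
open import Data.List.Relation.Binary.Permutation.Propositional using (_↭_)
open import Data.List.Relation.Binary.Permutation.Propositional.Properties using (↭-length)
open import Data.List.Relation.Unary.All as All using ([]; _∷_)
import Data.List.Relation.Unary.All.Properties as All
open import Data.List.Relation.Unary.Any using (here; there)
open import Data.List.Relation.Unary.Unique.Propositional using (Unique; []; _∷_)
import Data.List.Relation.Unary.Unique.Propositional.Properties as Unique
open import Data.Nat
  using (ℕ; zero; suc; _+_; _*_; _^_; _∸_; _/_; _≤_; _<_; _≟_; _<?_; z≤n; s≤s; s≤s⁻¹; z<s;
         NonZero; >-nonZero; ≢-nonZero⁻¹; nonTrivial⇒n>1)
open import Data.Nat.Coprimality using (Coprime; coprime-divisor; coprime⇒gcd≡1)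
open import Data.Nat.Divisibility
  using (_∣_; _∣?_; divides; divides-refl; 1∣_; n∣m*n; ∣-refl; ∣-trans; ∣1⇒≡1; 0∣⇒≡0; ∣⇒≤; m∣m*n; *-cancelʳ-∣)
open import Data.Nat.DivMod using (m*n/n≡m; n/n≡1)
open import Data.Nat.GCD using (gcd; gcd-comm; gcd-zeroˡ; gcd-zeroʳ)
open import Data.Nat.Induction using (<-wellFounded)
open import Data.Nat.ListAction using (product)
open import Data.Nat.ListAction.Properties using (product-↭)
open import Data.Nat.Primality using (Prime; prime[2]; prime⇒nonZero; prime⇒nonTrivial; prime⇒irreducible)
open import Data.Nat.Primality.Factorisation using (factorise)
open import Data.Nat.Properties
  using (suc-injective; +-suc; +-identityʳ; *-identityˡ; *-identityʳ; *-comm; *-assoc; *-cancelˡ-≡;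
         *-mono-<; m*n≢0; m*n≢0⇒m≢0; m*n≢0⇒n≢0; m<m*n; ^-*-assoc; ^-distribˡ-+-*; ^-monoʳ-<; m^n>0; m^n≢0;
         <-cmp; <-trans; <-irrefl; <-asym; <⇒≢; >⇒≢; ≤∧≢⇒<; ≮⇒≥; m≤n⇒m≤1+n; m∸n+n≡m; even≢odd;
         *-commutativeSemigroup; module ≤-Reasoning)
open import Algebra.Properties.CommutativeSemigroup *-commutativeSemigroup using (interchange)
open import Data.Product using (∃; ∃₂; _×_; _,_; proj₁; proj₂)
open import Data.Sum using (inj₁; inj₂)
open import Defs
open import Function.Base using (_∘_)
open import Function.Bundles using (_⇔_; mk⇔)
open import Induction.WellFounded using (Acc; acc)
open import Relation.Binary.Definitions using (DecidableEquality; tri<; tri≈; tri>)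
open import Relation.Binary.PropositionalEquality
  using (_≡_; _≢_; refl; sym; trans; cong; cong₂; subst; module ≡-Reasoning)
open import Relation.Nullary using (¬_; yes; no; ¬?; contradiction)
open import Relation.Unary using (Pred; Decidable)
open import Relation.Unary.Properties using (∁?)

module _ {A : Set} where

  ↭-unique : {xs ys : List A} → Unique xs → Unique ys → (∀ {x} → x ∈ xs ⇔ x ∈ ys) → xs ↭ ys
  ↭-unique uxs uys xs⇔ys = ∼bag⇒↭ (unique∧set⇒bag uxs uys xs⇔ys)

  unique-map⁺ : {B : Set} {f : A → B} {xs : List A} →
    (∀ {x y} → x ∈ xs → y ∈ xs → f x ≡ f y → x ≡ y) → Unique xs → Unique (map f xs)
  unique-map⁺ {xs = []} f-inj [] = []
  unique-map⁺ {xs = x ∷ xs} f-inj (x∉xs ∷ uxs) =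
    All.map⁺ (All.tabulate λ y∈xs fx≡fy → All.lookup x∉xs y∈xs (f-inj (here refl) (there y∈xs) fx≡fy))
    ∷ unique-map⁺ (λ x∈ y∈ → f-inj (there x∈) (there y∈)) uxs

  length-filter-∁ : ∀ {p} {P : Pred A p} (P? : Decidable P) (xs : List A) →
    length xs ≡ length (filter P? xs) + length (filter (∁? P?) xs)
  length-filter-∁ P? [] = refl
  length-filter-∁ P? (x ∷ xs) with P? x
  ... | yes _ = cong suc (length-filter-∁ P? xs)
  ... | no _ = trans (cong suc (length-filter-∁ P? xs)) (sym (+-suc _ _))

  module _ (_≟_ : DecidableEquality A) where

    open import Data.List.Membership.DecPropositional _≟_ using (_∈?_)

    unique-⊆⇒length≤ : {xs ys : List A} → Unique xs → Unique ys → (∀ {x} → x ∈ ys → x ∈ xs) →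
      length ys ≤ length xs
    unique-⊆⇒length≤ {xs} {ys} uxs uys ys⊆xs = begin
      length ys                   ≡⟨ ↭-length (↭-unique uys (Unique.filter⁺ (_∈? ys) uxs) (mk⇔ to from)) ⟩
      length (filter (_∈? ys) xs) ≤⟨ length-filter (_∈? ys) xs ⟩
      length xs                   ∎
      where
      open ≤-Reasoning
      to : ∀ {x} → x ∈ ys → x ∈ filter (_∈? ys) xs
      to x∈ys = ∈-filter⁺ (_∈? ys) (ys⊆xs x∈ys) x∈ys
      from : ∀ {x} → x ∈ filter (_∈? ys) xs → x ∈ ys
      from x∈ = proj₂ (∈-filter⁻ (_∈? ys) {xs = xs} x∈)

record InvolutionOn {A : Set} (f : A → A) (xs : List A) : Set where
  field
    closed     : ∀ {x} → x ∈ xs → f x ∈ xs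
    involutive : ∀ {x} → x ∈ xs → f (f x) ≡ x

  injective : ∀ {x y} → x ∈ xs → y ∈ xs → f x ≡ f y → x ≡ y
  injective {x} {y} x∈ y∈ fx≡fy = trans (sym (involutive x∈)) (trans (cong f fx≡fy) (involutive y∈))

  map-↭ : Unique xs → map f xs ↭ xs
  map-↭ uxs = ↭-unique (unique-map⁺ injective uxs) uxs (mk⇔ to from)
    where
    to : ∀ {y} → y ∈ map f xs → y ∈ xs
    to y∈ with ∈-map⁻ f y∈
    ... | x , x∈ , refl = closed x∈
    from : ∀ {y} → y ∈ xs → y ∈ map f xs
    from y∈ = subst (_∈ map f xs) (involutive y∈) (∈-map⁺ f (closed y∈))

product-*-product-map : ∀ (f : ℕ → ℕ) {m} xs → (∀ {x} → x ∈ xs → x * f x ≡ m) →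
  product xs * product (map f xs) ≡ m ^ length xs
product-*-product-map f [] pairs = refl
product-*-product-map f {m} (x ∷ xs) pairs = begin
  (x * product xs) * (f x * product (map f xs))
    ≡⟨ interchange x (product xs) (f x) (product (map f xs)) ⟩
  (x * f x) * (product xs * product (map f xs))
    ≡⟨ cong₂ _*_ (pairs (here refl)) (product-*-product-map f xs (pairs ∘ there)) ⟩
  m * m ^ length xs                             ∎
  where open ≡-Reasoning

module _ {f : ℕ → ℕ} {xs : List ℕ} (uxs : Unique xs) (inv : InvolutionOn f xs) where

  open InvolutionOn inv

  product-square : ∀ {m} → (∀ {x} → x ∈ xs → x * f x ≡ m) → product xs * product xs ≡ m ^ length xs
  product-square pairs = trans (cong (product xs *_) (sym (product-↭ (map-↭ uxs))))
    (product-*-product-map f xs pairs)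

  -- Elements moved by f come in pairs {x, f x}, one of them below its image and one above.
  length-involution : ∃ λ k → length xs ≡ length (filter (λ x → x ≟ f x) xs) + 2 * k
  length-involution = length below ,
    trans (length-filter-∁ (λ x → x ≟ f x) xs) (cong (length fixed +_) |moved|≡2|below|)
    where
    fixed moved below above : List ℕ
    fixed = filter (λ x → x ≟ f x) xs
    moved = filter (λ x → ¬? (x ≟ f x)) xs
    below = filter (λ x → x <? f x) moved
    above = filter (λ x → ¬? (x <? f x)) moved

    below⁺ : ∀ {x} → x ∈ xs → x < f x → x ∈ below
    below⁺ x∈ x<fx = ∈-filter⁺ _ (∈-filter⁺ _ x∈ λ x≡fx → <-irrefl x≡fx x<fx) x<fx
    below⁻ : ∀ {x} → x ∈ below → x ∈ xs × x < f x
    below⁻ x∈ = let x∈moved , x<fx = ∈-filter⁻ _ x∈ in proj₁ (∈-filter⁻ _ x∈moved) , x<fx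
    above⁺ : ∀ {x} → x ∈ xs → f x < x → x ∈ above
    above⁺ x∈ fx<x = ∈-filter⁺ _ (∈-filter⁺ _ x∈ λ x≡fx → <-irrefl (sym x≡fx) fx<x) (<-asym fx<x)
    above⁻ : ∀ {x} → x ∈ above → x ∈ xs × f x < x
    above⁻ x∈ =
      let x∈moved , x≮fx = ∈-filter⁻ _ x∈
          x∈xs , x≢fx = ∈-filter⁻ _ x∈moved
      in x∈xs , ≤∧≢⇒< (≮⇒≥ x≮fx) (λ fx≡x → x≢fx (sym fx≡x))

    unique-below : Unique below
    unique-below = Unique.filter⁺ _ (Unique.filter⁺ _ uxs)

    above↭map-below : above ↭ map f below
    above↭map-below = ↭-unique (Unique.filter⁺ _ (Unique.filter⁺ _ uxs))
      (unique-map⁺ (λ x∈ y∈ → injective (proj₁ (below⁻ x∈)) (proj₁ (below⁻ y∈))) unique-below)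
      (mk⇔ to from)
      where
      to : ∀ {y} → y ∈ above → y ∈ map f below
      to y∈ = let y∈xs , fy<y = above⁻ y∈ in
        subst (_∈ map f below) (involutive y∈xs)
          (∈-map⁺ f (below⁺ (closed y∈xs) (subst (f _ <_) (sym (involutive y∈xs)) fy<y)))
      from : ∀ {y} → y ∈ map f below → y ∈ above
      from y∈ with ∈-map⁻ f y∈
      ... | x , x∈ , refl = let x∈xs , x<fx = below⁻ x∈ in
        above⁺ (closed x∈xs) (subst (_< f x) (sym (involutive x∈xs)) x<fx)

    |moved|≡2|below| : length moved ≡ 2 * length below
    |moved|≡2|below| = trans (length-filter-∁ (λ x → x <? f x) moved) (cong (length below +_) (begin
      length above         ≡⟨ ↭-length above↭map-below ⟩
      length (map f below) ≡⟨ length-map f below ⟩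
      length below         ≡⟨ +-identityʳ (length below) ⟨
      length below + 0     ∎))
      where open ≡-Reasoning

^-distribʳ-* : ∀ x y e → (x * y) ^ e ≡ x ^ e * y ^ e
^-distribʳ-* x y zero = refl
^-distribʳ-* x y (suc e) =
  trans (cong ((x * y) *_) (^-distribʳ-* x y e)) (interchange x y (x ^ e) (y ^ e))

^-double : ∀ x e → x ^ (2 * e) ≡ x ^ e * x ^ e
^-double x e = trans (cong (λ f → x ^ (e + f)) (+-identityʳ e)) (^-distribˡ-+-* x e e)

^-cancelˡ-≡ : ∀ {x a b} → 1 < x → x ^ a ≡ x ^ b → a ≡ b
^-cancelˡ-≡ {x} {a} {b} 1<x xᵃ≡xᵇ with <-cmp a b
... | tri< a<b _ _ = contradiction xᵃ≡xᵇ (<⇒≢ (^-monoʳ-< x 1<x a<b))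
... | tri≈ _ a≡b _ = a≡b
... | tri> _ _ b<a = contradiction (sym xᵃ≡xᵇ) (<⇒≢ (^-monoʳ-< x 1<x b<a))

m*m≡n*n⇒m≡n : ∀ {m n} → m * m ≡ n * n → m ≡ n
m*m≡n*n⇒m≡n {m} {n} m²≡n² with <-cmp m n
... | tri< m<n _ _ = contradiction m²≡n² (<⇒≢ (*-mono-< m<n m<n))
... | tri≈ _ m≡n _ = m≡n
... | tri> _ _ n<m = contradiction (sym m²≡n²) (<⇒≢ (*-mono-< n<m n<m))

^-monoʳ-∣ : ∀ p {i a} → i ≤ a → p ^ i ∣ p ^ a
^-monoʳ-∣ p {i} {a} i≤a = divides (p ^ (a ∸ i))
  (trans (cong (p ^_) (sym (m∸n+n≡m i≤a))) (^-distribˡ-+-* p (a ∸ i) i))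

prime>1 : ∀ {p} → Prime p → 1 < p
prime>1 {p} p-prime = nonTrivial⇒n>1 p {{prime⇒nonTrivial p-prime}}

∣p^a⇒≡p^i : ∀ {p d} a → Prime p → d ∣ p ^ a → ∃ λ i → i ≤ a × d ≡ p ^ i
∣p^a⇒≡p^i zero _ d∣1 = 0 , z≤n , ∣1⇒≡1 d∣1
∣p^a⇒≡p^i {p} {d} (suc a) p-prime d∣p^[1+a] with p ∣? d
... | yes (divides-refl e) =
  let i , i≤a , e≡pⁱ = ∣p^a⇒≡p^i {p} {e} a p-prime (*-cancelʳ-∣ p e*p∣pᵃ*p)
  in suc i , s≤s i≤a , trans (cong (_* p) e≡pⁱ) (*-comm (p ^ i) p)
  where
  instance
    p≢0 : NonZero p
    p≢0 = prime⇒nonZero p-prime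
  e*p∣pᵃ*p : e * p ∣ p ^ a * p
  e*p∣pᵃ*p = subst (e * p ∣_) (*-comm p (p ^ a)) d∣p^[1+a]
... | no p∤d =
  let i , i≤a , d≡pⁱ = ∣p^a⇒≡p^i a p-prime (coprime-divisor d⊥p d∣p^[1+a])
  in i , m≤n⇒m≤1+n i≤a , d≡pⁱ
  where
  d⊥p : Coprime d p
  d⊥p (i∣d , i∣p) with prime⇒irreducible p-prime i∣p
  ... | inj₁ i≡1    = i≡1
  ... | inj₂ refl   = contradiction i∣d p∤d

gcd[p^a,r]≡1 : ∀ {p r} a → Prime p → ¬ p ∣ r → gcd (p ^ a) r ≡ 1
gcd[p^a,r]≡1 {p} {r} a p-prime p∤r = coprime⇒gcd≡1 pᵃ⊥r
  where
  pᵃ⊥r : Coprime (p ^ a) r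
  pᵃ⊥r (i∣pᵃ , i∣r) with ∣p^a⇒≡p^i a p-prime i∣pᵃ
  ... | zero  , _ , i≡1    = i≡1
  ... | suc j , _ , refl   = contradiction (∣-trans (m∣m*n (p ^ j)) i∣r) p∤r

prime-power-split : ∀ {p} → Prime p → ∀ n .{{_ : NonZero n}} → ∃₂ λ a r → n ≡ p ^ a * r × ¬ p ∣ r
prime-power-split {p} p-prime n = split n (<-wellFounded n)
  where
  split : ∀ n .{{_ : NonZero n}} → Acc _<_ n → ∃₂ λ a r → n ≡ p ^ a * r × ¬ p ∣ r
  split n (acc rec) with p ∣? n
  ... | no p∤n = 0 , n , sym (*-identityˡ n) , p∤n
  ... | yes (divides-refl q) =
    let a , r , q≡pᵃr , p∤r = split q (rec (m<m*n q p (prime>1 p-prime)))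
    in suc a , r , q*p≡p*pᵃ*r {a} q≡pᵃr , p∤r
    where
    instance
      q≢0 : NonZero q
      q≢0 = m*n≢0⇒m≢0 q
    q*p≡p*pᵃ*r : ∀ {a r} → q ≡ p ^ a * r → q * p ≡ p * p ^ a * r
    q*p≡p*pᵃ*r {a} {r} refl = trans (*-comm (p ^ a * r) p) (sym (*-assoc p (p ^ a) r))

∃prime∣ : ∀ {n} → 1 < n → ∃ λ p → Prime p × p ∣ n
∃prime∣ {n} 1<n with factorise n {{>-nonZero (<-trans z<s 1<n)}}
... | record { factors = [] ; isFactorisation = n≡1 } = contradiction n≡1 (>⇒≢ 1<n)
... | record { factors = p ∷ ps ; isFactorisation = n≡p*Πps ; factorsPrime = p-prime ∷ _ } =
  p , p-prime , divides (product ps) (trans n≡p*Πps (*-comm p (product ps)))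

τ : ℕ → ℕ
τ m = length (divisors m)

τ* : ℕ → ℕ
τ* n = length (unitaryDivisors n)

cofactor-/ : ∀ m d .{{_ : NonZero d}} → cofactor m d ≡ m / d
cofactor-/ m (suc d) = refl

cofactor-*ʳ : ∀ q d .{{_ : NonZero d}} → cofactor (q * d) d ≡ q
cofactor-*ʳ q d = trans (cofactor-/ (q * d) d) (m*n/n≡m q d)

module _ {m d : ℕ} .{{_ : NonZero m}} where

  *-cofactor : d ∣ m → d * cofactor m d ≡ m
  *-cofactor (divides-refl q) = trans (cong (d *_) (cofactor-*ʳ q d)) (*-comm d q)
    where
    instance
      d≢0 : NonZero d
      d≢0 = m*n≢0⇒n≢0 q

  cofactor-∣ : d ∣ m → cofactor m d ∣ m
  cofactor-∣ (divides-refl q) = subst (_∣ q * d) (sym (cofactor-*ʳ q d)) (m∣m*n d)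
    where
    instance
      d≢0 : NonZero d
      d≢0 = m*n≢0⇒n≢0 q

  cofactor-involutive : d ∣ m → cofactor m (cofactor m d) ≡ d
  cofactor-involutive (divides-refl q) = begin
    cofactor (q * d) (cofactor (q * d) d) ≡⟨ cong (cofactor (q * d)) (cofactor-*ʳ q d) ⟩
    cofactor (q * d) q                    ≡⟨ cong (λ m → cofactor m q) (*-comm q d) ⟩
    cofactor (d * q) q                    ≡⟨ cofactor-*ʳ d q ⟩
    d                                     ∎
    where
    open ≡-Reasoning
    instance
      d≢0 : NonZero d
      d≢0 = m*n≢0⇒n≢0 q
      q≢0 : NonZero q
      q≢0 = m*n≢0⇒m≢0 q

∈-divisors⁺ : ∀ {m d} .{{_ : NonZero m}} → d ∣ m → d ∈ divisors m
∈-divisors⁺ {m} {zero} 0∣m = contradiction (0∣⇒≡0 0∣m) (≢-nonZero⁻¹ m)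
∈-divisors⁺ {m} {suc d} d∣m = ∈-filter⁺ (_∣? m) (∈-applyUpTo⁺ suc (∣⇒≤ d∣m)) d∣m

∈-divisors⁻ : ∀ {m d} → d ∈ divisors m → NonZero m × d ∣ m
∈-divisors⁻ {m} d∈ with ∈-filter⁻ (_∣? m) {xs = range1 m} d∈
... | d∈range , d∣m with ∈-applyUpTo⁻ suc d∈range
... | _ , s≤s _ , refl = _ , d∣m

divisors-unique : ∀ m → Unique (divisors m)
divisors-unique m =
  Unique.filter⁺ (_∣? m) (Unique.applyUpTo⁺₁ suc m (λ i<j _ → <⇒≢ i<j ∘ suc-injective))

∈-divisors⇒*-cofactor : ∀ {m d} → d ∈ divisors m → d * cofactor m d ≡ m
∈-divisors⇒*-cofactor d∈ = let m≢0 , d∣m = ∈-divisors⁻ d∈ in *-cofactor {{m≢0}} d∣m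

cofactor-involution : ∀ m → InvolutionOn (cofactor m) (divisors m)
cofactor-involution m = record
  { closed     = λ d∈ → let m≢0 , d∣m = ∈-divisors⁻ d∈ in
                         ∈-divisors⁺ {{m≢0}} (cofactor-∣ {{m≢0}} d∣m)
  ; involutive = λ d∈ → let m≢0 , d∣m = ∈-divisors⁻ d∈ in cofactor-involutive {{m≢0}} d∣m
  }

T-square : ∀ m → T m * T m ≡ m ^ τ m
T-square m = product-square (divisors-unique m) (cofactor-involution m) ∈-divisors⇒*-cofactor

∈-unitaryDivisors⁺ : ∀ {n d} → d ∈ divisors n → gcd d (cofactor n d) ≡ 1 → d ∈ unitaryDivisors n
∈-unitaryDivisors⁺ {n} = ∈-filter⁺ (λ d → gcd d (cofactor n d) ≟ 1)

∈-unitaryDivisors⁻ : ∀ {n d} → d ∈ unitaryDivisors n → d ∈ divisors n × gcd d (cofactor n d) ≡ 1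
∈-unitaryDivisors⁻ {n} = ∈-filter⁻ (λ d → gcd d (cofactor n d) ≟ 1) {xs = divisors n}

unitaryDivisors-unique : ∀ n → Unique (unitaryDivisors n)
unitaryDivisors-unique n = Unique.filter⁺ (λ d → gcd d (cofactor n d) ≟ 1) (divisors-unique n)

unitary-cofactor-involution : ∀ n → InvolutionOn (cofactor n) (unitaryDivisors n)
unitary-cofactor-involution n = record
  { closed     = closed
  ; involutive = involutive ∘ proj₁ ∘ ∈-unitaryDivisors⁻ {n}
  }
  where
  open InvolutionOn (cofactor-involution n) using (involutive) renaming (closed to divisors-closed)
  closed : ∀ {d} → d ∈ unitaryDivisors n → cofactor n d ∈ unitaryDivisors n
  closed {d} d∈ = let d∈divisors , gcd≡1 = ∈-unitaryDivisors⁻ {n} d∈ in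
    ∈-unitaryDivisors⁺ (divisors-closed d∈divisors) (begin
      gcd (cofactor n d) (cofactor n (cofactor n d)) ≡⟨ cong (gcd (cofactor n d)) (involutive d∈divisors) ⟩
      gcd (cofactor n d) d                           ≡⟨ gcd-comm (cofactor n d) d ⟩
      gcd d (cofactor n d)                           ≡⟨ gcd≡1 ⟩
      1                                              ∎)
    where open ≡-Reasoning

T*-square : ∀ n → T* n * T* n ≡ n ^ τ* n
T*-square n = product-square (unitaryDivisors-unique n) (unitary-cofactor-involution n)
  (∈-divisors⇒*-cofactor ∘ proj₁ ∘ ∈-unitaryDivisors⁻ {n})

1∈unitaryDivisors : ∀ n .{{_ : NonZero n}} → 1 ∈ unitaryDivisors n
1∈unitaryDivisors n = ∈-unitaryDivisors⁺ {n} (∈-divisors⁺ (1∣ n)) (gcd-zeroˡ (cofactor n 1))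

n∈unitaryDivisors : ∀ n .{{_ : NonZero n}} → n ∈ unitaryDivisors n
n∈unitaryDivisors n = ∈-unitaryDivisors⁺ {n} (∈-divisors⁺ ∣-refl)
  (trans (cong (gcd n) (trans (cofactor-/ n n) (n/n≡1 n))) (gcd-zeroʳ n))

τ≥2 : ∀ {m} → 1 < m → 2 ≤ τ m
τ≥2 {m} 1<m = unique-⊆⇒length≤ _≟_ (divisors-unique m) ((<⇒≢ 1<m ∷ []) ∷ [] ∷ []) 1,m∈
  where
  instance
    m≢0 : NonZero m
    m≢0 = >-nonZero (<-trans z<s 1<m)
  1,m∈ : ∀ {d} → d ∈ 1 ∷ m ∷ [] → d ∈ divisors m
  1,m∈ (here refl)         = ∈-divisors⁺ (1∣ m)
  1,m∈ (there (here refl)) = ∈-divisors⁺ ∣-refl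

τ*≥2 : ∀ {n} → 1 < n → 2 ≤ τ* n
τ*≥2 {n} 1<n = unique-⊆⇒length≤ _≟_ (unitaryDivisors-unique n) ((<⇒≢ 1<n ∷ []) ∷ [] ∷ []) 1,n∈
  where
  instance
    n≢0 : NonZero n
    n≢0 = >-nonZero (<-trans z<s 1<n)
  1,n∈ : ∀ {d} → d ∈ 1 ∷ n ∷ [] → d ∈ unitaryDivisors n
  1,n∈ (here refl)         = 1∈unitaryDivisors n
  1,n∈ (there (here refl)) = n∈unitaryDivisors n

-- The only fixed point of d ↦ c² / d is c, so the other divisors of c² pair off.
τ[c*c]-odd : ∀ c .{{_ : NonZero c}} → ∃ λ k → τ (c * c) ≡ 1 + 2 * k
τ[c*c]-odd c with length-involution (divisors-unique (c * c)) (cofactor-involution (c * c))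
... | k , τ≡ = k , trans τ≡ (cong (_+ 2 * k) (↭-length fixed↭[c]))
  where
  fixed? : Decidable (λ d → d ≡ cofactor (c * c) d)
  fixed? d = d ≟ cofactor (c * c) d

  fixed↭[c] : filter fixed? (divisors (c * c)) ↭ [ c ]
  fixed↭[c] = ↭-unique (Unique.filter⁺ fixed? (divisors-unique (c * c))) ([] ∷ []) (mk⇔ to from)
    where
    to : ∀ {d} → d ∈ filter fixed? (divisors (c * c)) → d ∈ [ c ]
    to {d} d∈ = let d∈divisors , d≡cofactor = ∈-filter⁻ fixed? {xs = divisors (c * c)} d∈ in
      here (m*m≡n*n⇒m≡n (trans (cong (d *_) d≡cofactor) (∈-divisors⇒*-cofactor d∈divisors)))
    from : ∀ {d} → d ∈ [ c ] → d ∈ filter fixed? (divisors (c * c))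
    from (here refl) = ∈-filter⁺ fixed? (∈-divisors⁺ {{m*n≢0 c c}} (divides-refl c)) (sym (cofactor-*ʳ c c))

τ[c*c]≢2^ : ∀ {c} t → 1 < c → τ (c * c) ≢ 2 ^ t
τ[c*c]≢2^ zero    1<c τ≡1   = <⇒≢ (τ≥2 (*-mono-< 1<c 1<c)) (sym τ≡1)
τ[c*c]≢2^ {c} (suc t) 1<c τ≡2ᵗ =
  let k , τ≡1+2k = τ[c*c]-odd c {{>-nonZero (<-trans z<s 1<c)}} in even≢odd (2 ^ t) k (trans (sym τ≡2ᵗ) τ≡1+2k)

τ[p^a]≡1+a : ∀ {p} a → Prime p → τ (p ^ a) ≡ suc a
τ[p^a]≡1+a {p} a p-prime = begin
  τ (p ^ a)                            ≡⟨ ↭-length divisors↭powers ⟩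
  length (map (p ^_) (upTo (suc a)))   ≡⟨ length-map (p ^_) (upTo (suc a)) ⟩
  length (upTo (suc a))                ≡⟨ length-upTo (suc a) ⟩
  suc a                                ∎
  where
  open ≡-Reasoning
  instance
    p≢0 : NonZero p
    p≢0 = prime⇒nonZero p-prime
  divisors↭powers : divisors (p ^ a) ↭ map (p ^_) (upTo (suc a))
  divisors↭powers = ↭-unique (divisors-unique (p ^ a))
    (Unique.map⁺ (^-cancelˡ-≡ (prime>1 p-prime)) (Unique.upTo⁺ (suc a))) (mk⇔ to from)
    where
    to : ∀ {d} → d ∈ divisors (p ^ a) → d ∈ map (p ^_) (upTo (suc a))
    to d∈ with ∣p^a⇒≡p^i a p-prime (proj₂ (∈-divisors⁻ d∈))
    ... | i , i≤a , refl = ∈-map⁺ (p ^_) (∈-upTo⁺ (s≤s i≤a))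
    from : ∀ {d} → d ∈ map (p ^_) (upTo (suc a)) → d ∈ divisors (p ^ a)
    from d∈ with ∈-map⁻ (p ^_) d∈
    ... | i , i∈ , refl = ∈-divisors⁺ {{m^n≢0 p a}} (^-monoʳ-∣ p (s≤s⁻¹ (∈-upTo⁻ i∈)))

perfect⇒τ*τ[T*]≡4K : ∀ K {n} → 1 < n → IsKT0T*Perfect K n → τ* n * τ (T* n) ≡ 2 * (2 * K)
perfect⇒τ*τ[T*]≡4K K {n} 1<n T[T*n]≡nᴷ = ^-cancelˡ-≡ 1<n (begin
  n ^ (u * t)                       ≡⟨ sym (^-*-assoc n u t) ⟩
  (n ^ u) ^ t                       ≡⟨ cong (_^ t) (sym (T*-square n)) ⟩
  (m * m) ^ t                       ≡⟨ ^-distribʳ-* m m t ⟩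
  m ^ t * m ^ t                     ≡⟨ cong (λ x → x * x) (sym (T-square m)) ⟩
  (T m * T m) * (T m * T m)         ≡⟨ cong (λ x → (x * x) * (x * x)) T[T*n]≡nᴷ ⟩
  (n ^ K * n ^ K) * (n ^ K * n ^ K) ≡⟨ cong (λ x → x * x) (sym (^-double n K)) ⟩
  n ^ (2 * K) * n ^ (2 * K)         ≡⟨ sym (^-double n (2 * K)) ⟩
  n ^ (2 * (2 * K))                 ∎)
  where
  open ≡-Reasoning
  m u t : ℕ
  m = T* n
  u = τ* n
  t = τ m

τ*≡2j⇒T*≡n^j : ∀ n j → τ* n ≡ 2 * j → T* n ≡ n ^ j
τ*≡2j⇒T*≡n^j n j τ*≡2j = m*m≡n*n⇒m≡n (trans (T*-square n) (trans (cong (n ^_) τ*≡2j) (^-double n j)))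

τ*τ[T*]≡2^e⇒τ*≡2 : ∀ {n} e → 1 < n → τ* n * τ (T* n) ≡ 2 ^ e → τ* n ≡ 2
τ*τ[T*]≡2^e⇒τ*≡2 {n} e 1<n counts with ∣p^a⇒≡p^i e prime[2] (subst (τ* n ∣_) counts (m∣m*n (τ (T* n))))
... | zero          , _ , τ*≡1 = contradiction (sym τ*≡1) (<⇒≢ (τ*≥2 1<n))
... | suc zero      , _ , τ*≡2 = τ*≡2
... | suc (suc s)   , _ , τ*≡4·2ˢ with ∣p^a⇒≡p^i e prime[2] (subst (τ (T* n) ∣_) counts (n∣m*n (τ* n)))
...   | t , _ , τ≡2ᵗ = contradiction (trans (cong τ (sym T*n≡c*c)) τ≡2ᵗ) (τ[c*c]≢2^ t 1<c)
  where
  c : ℕ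
  c = n ^ 2 ^ s
  1<c : 1 < c
  1<c = ^-monoʳ-< n 1<n (m^n>0 2 s)
  T*n≡c*c : T* n ≡ c * c
  T*n≡c*c = trans (τ*≡2j⇒T*≡n^j n (2 * 2 ^ s) τ*≡4·2ˢ) (^-double n (2 ^ s))

perfect∧τ*≡2⇒τ≡2K : ∀ K {n} → 1 < n → IsKT0T*Perfect K n → τ* n ≡ 2 → τ n ≡ 2 * K
perfect∧τ*≡2⇒τ≡2K K {n} 1<n perfect τ*n≡2 = *-cancelˡ-≡ (τ n) (2 * K) 2 (begin
  2 * τ n         ≡⟨ cong₂ (λ u m → u * τ m) (sym τ*n≡2) (sym T*n≡n) ⟩
  τ* n * τ (T* n) ≡⟨ perfect⇒τ*τ[T*]≡4K K 1<n perfect ⟩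
  2 * (2 * K)     ∎)
  where
  open ≡-Reasoning
  T*n≡n : T* n ≡ n
  T*n≡n = trans (τ*≡2j⇒T*≡n^j n 1 τ*n≡2) (*-identityʳ n)

-- Write n = p^a r with p ∣ n prime and p ∤ r; if r ≠ 1 then 1, p^a and n are three unitary divisors.
τ*≡2⇒prime-power : ∀ {n} → 1 < n → τ* n ≡ 2 → ∃₂ λ p a → Prime p × n ≡ p ^ a
τ*≡2⇒prime-power {n} 1<n τ*≡2 with ∃prime∣ 1<n
... | p , p-prime , p∣n with prime-power-split p-prime n {{>-nonZero (<-trans z<s 1<n)}}
...   | a , r , n≡pᵃr , p∤r with r ≟ 1
...     | yes refl = p , a , p-prime , trans n≡pᵃr (*-identityʳ (p ^ a))
...     | no r≢1 = contradiction τ*≡2 (>⇒≢ (unique-⊆⇒length≤ _≟_ (unitaryDivisors-unique n)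
            ((1≢pᵃ ∷ <⇒≢ 1<n ∷ []) ∷ (pᵃ≢n ∷ []) ∷ [] ∷ []) 1,pᵃ,n∈))
  where
  instance
    n≢0 : NonZero n
    n≢0 = >-nonZero (<-trans z<s 1<n)
    pᵃ≢0 : NonZero (p ^ a)
    pᵃ≢0 = m^n≢0 p a {{prime⇒nonZero p-prime}}
  1≢pᵃ : 1 ≢ p ^ a
  1≢pᵃ 1≡pᵃ = p∤r (subst (p ∣_) (trans n≡pᵃr (trans (cong (_* r) (sym 1≡pᵃ)) (*-identityˡ r))) p∣n)
  pᵃ≢n : p ^ a ≢ n
  pᵃ≢n pᵃ≡n = r≢1 (*-cancelˡ-≡ r 1 (p ^ a)
    (trans (sym n≡pᵃr) (trans (sym pᵃ≡n) (sym (*-identityʳ (p ^ a))))))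
  pᵃ∈ : p ^ a ∈ unitaryDivisors n
  pᵃ∈ = ∈-unitaryDivisors⁺ {n} (∈-divisors⁺ (divides r (trans n≡pᵃr (*-comm (p ^ a) r))))
    (trans (cong (gcd (p ^ a)) cofactor≡r) (gcd[p^a,r]≡1 a p-prime p∤r))
    where
    cofactor≡r : cofactor n (p ^ a) ≡ r
    cofactor≡r = trans (cong (λ m → cofactor m (p ^ a)) (trans n≡pᵃr (*-comm (p ^ a) r)))
      (cofactor-*ʳ r (p ^ a))
  1,pᵃ,n∈ : ∀ {d} → d ∈ 1 ∷ p ^ a ∷ n ∷ [] → d ∈ unitaryDivisors n
  1,pᵃ,n∈ (here refl)                 = 1∈unitaryDivisors n
  1,pᵃ,n∈ (there (here refl))         = pᵃ∈
  1,pᵃ,n∈ (there (there (here refl))) = n∈unitaryDivisors n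

-- The argument never uses 1 ≤ k.
corollary3p6 : (k n : ℕ) → 1 ≤ k → 1 < n → IsKT0T*Perfect (2 ^ k) n →
    ∃ λ p → Prime p × n ≡ p ^ (2 ^ (suc k) ∸ 1)
corollary3p6 k n _ 1<n perfect =
  let p , a , p-prime , n≡pᵃ = τ*≡2⇒prime-power 1<n τ*n≡2 in
  p , p-prime , trans n≡pᵃ (cong (λ e → p ^ (e ∸ 1)) (begin
    suc a     ≡⟨ sym (τ[p^a]≡1+a a p-prime) ⟩
    τ (p ^ a) ≡⟨ cong τ (sym n≡pᵃ) ⟩
    τ n       ≡⟨ perfect∧τ*≡2⇒τ≡2K (2 ^ k) 1<n perfect τ*n≡2 ⟩
    2 ^ suc k ∎))
  where
  open ≡-Reasoning
  τ*n≡2 : τ* n ≡ 2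
  τ*n≡2 = τ*τ[T*]≡2^e⇒τ*≡2 (suc (suc k)) 1<n (perfect⇒τ*τ[T*]≡4K (2 ^ k) 1<n perfect)
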